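{- Let $n\ge 2$, and in $S_{n+1}$ let $a_i=(1,2)(i+1,i+2)$ for $1\le i\le n-1$. For $1\le j\le n-1$ let $$R^A_j=\{1,\ a_j,\ a_ja_{j-1},\ \dots,\ a_j\cdots a_2,\ a_j\cdots a_2a_1,\ a_j\cdots a_2a_1^{ -1}\}\subseteq A_{n+1}.$$ Then for every $v\in A_{n+1}$ there exist unique elements $v_j\in R^A_j$ ($1\le j\le n-1$) such that $v=v_1v_2\cdots v_{n-1}$.
   Context: Products of permutations are compositions of functions, $(\sigma\tau)(k)=\sigma(\tau(k))$. For $j=1$ the set $R^A_1$ is $\{1,a_1,a_1^{ -1}\}$. -}

module Defs where

open import Data.Nat using (ℕ; zero; suc; _+_; _<?_)
open import Data.Nat.Divisibility using (_∣_)
open import Data.Fin using (Fin; fromℕ<)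
open import Data.Fin.Properties using () renaming (_<?_ to _<ᶠ?_)
open import Data.Fin.Permutation using (Permutation′; _⟨$⟩ʳ_; _∘ₚ_; flip; transpose)
  renaming (id to idₚ)
open import Data.List using (List; []; _∷_; _++_; map; length; filter; cartesianProduct; allFin)
open import Data.List.Relation.Unary.Any using (Any)
open import Data.Product using (_×_; _,_)
open import Relation.Binary.PropositionalEquality using (_≡_)
open import Relation.Nullary.Decidable using (yes; no; _×-dec_)

-- Permutations of {0,…,m-1} (0-based labels for the points 1,…,m of the paper).
Perm : ℕ → Set
Perm = Permutation′

-- Paper's product convention: (σ · τ)(k) = σ (τ k).
-- (stdlib's _∘ₚ_ is diagrammatic: (π₁ ∘ₚ π₂) ⟨$⟩ʳ k = π₂ ⟨$⟩ʳ (π₁ ⟨$⟩ʳ k).)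
infixr 9 _·_
_·_ : ∀ {m} → Perm m → Perm m → Perm m
σ · τ = τ ∘ₚ σ

one : ∀ {m} → Perm m
one = idₚ

inv : ∀ {m} → Perm m → Perm m
inv = flip

infix 4 _≈_
_≈_ : ∀ {m} → Perm m → Perm m → Set
σ ≈ τ = ∀ i → σ ⟨$⟩ʳ i ≡ τ ⟨$⟩ʳ i

-- Transposition of the 0-based points p and q (identity if a point is out of range;
-- this fallback is never used in the statement).
tr : (m p q : ℕ) → Perm m
tr m p q with p <? m | q <? m
... | yes p<m | yes q<m = transpose (fromℕ< p<m) (fromℕ< q<m)
... | _ | _ = one

-- a n l  is the paper's  a_{l+1} = (1,2)(l+2,l+3)  in S_{n+1}  (0-based index l, 1-based points).
-- In 0-based points: (0,1)(l+1,l+2).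
a : (n l : ℕ) → Perm (suc n)
a n l = tr (suc n) 0 1 · tr (suc n) (suc l) (suc (suc l))

descs : ∀ {m} → (ℕ → Perm m) → ℕ → List (Perm m)
descs s zero = s zero ∷ []
descs s (suc j) = s (suc j) ∷ map (s (suc j) ·_) (descs s j)

top : ∀ {m} → (ℕ → Perm m) → ℕ → Perm m
top s zero = one
top s (suc j) = s (suc j) · top s j

-- R n j  is the paper's  R^A_{j+1} as a list:
-- { 1, a_{j+1}, a_{j+1}a_j, …, a_{j+1}⋯a_1, a_{j+1}⋯a_2 a_1⁻¹ }
R : (n j : ℕ) → List (Perm (suc n))
R n j = one ∷ descs (a n) j ++ (top (a n) j · inv (a n 0)) ∷ []

infix 4 _∈ᴾ_
_∈ᴾ_ : ∀ {m} → Perm m → List (Perm m) → Set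
σ ∈ᴾ xs = Any (σ ≈_) xs

prod : ∀ {m l} → (Fin l → Perm m) → Perm m
prod {l = zero} v = one
prod {l = suc l} v = v Fin.zero · prod (λ i → v (Fin.suc i))

inversions : ∀ {m} → Perm m → ℕ
inversions {m} σ =
  length (filter (λ { (i , j) → (i <ᶠ? j) ×-dec ((σ ⟨$⟩ʳ j) <ᶠ? (σ ⟨$⟩ʳ i)) })
                 (cartesianProduct (allFin m) (allFin m)))

IsEven : ∀ {m} → Perm m → Set
IsEven σ = 2 ∣ inversions σ

-- Write A_{t+1} for the even permutations fixing every point above t (points are 0-based, so
-- a_{l+1} = (0 1)(l+1 l+2)).  Put c = k+2.  The map r ↦ r⁻¹(c) sends the elements
-- 1, a_{k+1}, a_{k+1}a_k, …, a_{k+1}⋯a_1, a_{k+1}⋯a_2 a_1⁻¹ of R^A_{k+1} to c, c-1, …, 1, 0,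
-- so R^A_{k+1} is a transversal of the right cosets of A_{k+2} in A_{k+3}: every v ∈ A_{k+3}
-- is h·r with h ∈ A_{k+2} and r ∈ R^A_{k+1}, where r is forced by r⁻¹(c) = v⁻¹(c).  Splitting
-- off last factors one at a time gives existence and uniqueness; the recursion ends in A_2,
-- which is trivial because (0 1) is odd.  Parity is the xor of the inversion indicators; it
-- is multiplicative because over 𝔽₂ the pairs inverted by στ are those inverted by τ plus
-- those whose images under τ are inverted by σ.

module Submission where

open import Defs
open import Data.Nat using (ℕ; _≤_; _∸_; suc)
open import Data.Fin using (Fin; toℕ)
open import Data.Product using (Σ; _×_)

open import Algebra.Bundles using (CommutativeRing)
open import Data.Bool using (Bool; true; false; not; _∧_; _xor_; if_then_else_)
open import Data.Bool.Properties
  using ( not-involutive; xor-∧-commutativeRing; xor-same; xor-assoc; xor-comm; xor-identityʳ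
        ; xor-annihilates-not; ∧-distribˡ-xor; ∧-distribʳ-xor; ∧-zeroʳ; ∧-identityʳ)
open import Data.Fin as Fin using (fromℕ<; inject₁; fromℕ)
open import Data.Fin.Patterns using (0F; 1F)
open import Data.Fin.Properties
  using (_<?_; <-cmp; <-asym; <-irrefl; toℕ-injective; toℕ-fromℕ<; toℕ<n; toℕ-inject₁; toℕ-fromℕ)
open import Data.Fin.Permutation using (_⟨$⟩ʳ_; _⟨$⟩ˡ_; inverseˡ; inverseʳ; transpose)
import Data.Fin.Permutation.Components as PC
open import Data.List
  using (List; []; _∷_; _++_; map; foldr; length; filter; cartesianProduct; tabulate; allFin; applyDownFrom; downFrom)
open import Data.List.Properties using (map-++; map-∘; downFrom-∷ʳ)
open import Data.List.Membership.Propositional using (_∈_)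
open import Data.List.Membership.Propositional.Properties using (∈-downFrom⁺)
import Data.List.Membership.Setoid.Properties as Membershipₛ
open import Data.List.Relation.Unary.All as All using (All; []; _∷_)
import Data.List.Relation.Unary.All.Properties as All
open import Data.List.Relation.Unary.Any using (here; there)
open import Data.List.Relation.Unary.AllPairs using (_∷_)
open import Data.List.Relation.Unary.Unique.Propositional using (Unique)
open import Data.List.Relation.Unary.Unique.Propositional.Properties using (downFrom⁺)
open import Data.Nat as ℕ using (zero; _<_; _*_; s≤s; z≤n)
open import Data.Nat.Divisibility using (divides)
open import Data.Nat.Properties
  using (≤-trans; ≤-<-trans; ≤-refl; ≤-reflexive; n≤1+n; <-trans; n<1+n; >⇒≢; ≰⇒>; ≤∧≢⇒<; ≤⇒≯)
open import Data.Product using (∃-syntax; _,_; proj₁; proj₂)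
open import Data.Sum using (_⊎_; inj₁; inj₂)
open import Data.Vec.Functional using (Vector; init; last)
open import Function using (_∘_; id)
open import Relation.Binary.Bundles using (Setoid)
open import Relation.Binary.Definitions using (tri<; tri≈; tri>)
open import Relation.Binary.PropositionalEquality
open import Relation.Nullary using (does; yes; no; contradiction)
open import Relation.Nullary.Decidable using (dec-true; dec-false)
open import Relation.Unary using (Decidable)
open import Algebra.Properties.Semiring.Sum (CommutativeRing.semiring xor-∧-commutativeRing)
  using (sum; sum-cong-≗; sum-replicate-zero; ∑-distrib-+; ∑-permute; *-distribˡ-sum)

xor-telescope : ∀ a b c → (a xor b) xor (b xor c) ≡ a xor c
xor-telescope false false c = refl
xor-telescope false true c = not-involutive c
xor-telescope true false c = refl
xor-telescope true true c = refl

xor-recover : ∀ a b → b xor (a xor b) ≡ a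
xor-recover a false = xor-identityʳ a
xor-recover false true = refl
xor-recover true true = refl

xor-cancel : ∀ a b → a xor b ≡ false → b ≡ a
xor-cancel false b eq = eq
xor-cancel true false ()
xor-cancel true true eq = refl

∧-guard : ∀ b {x y} → (b ≡ true → x ≡ y) → b ∧ x ≡ b ∧ y
∧-guard false _ = refl
∧-guard true x≡y = x≡y refl

∑∑ : ∀ {m} → (Fin m → Fin m → Bool) → Bool
∑∑ f = sum λ i → sum λ j → f i j

∑∑-cong : ∀ {m} {f g : Fin m → Fin m → Bool} → (∀ i j → f i j ≡ g i j) → ∑∑ f ≡ ∑∑ g
∑∑-cong f≡g = sum-cong-≗ λ i → sum-cong-≗ (f≡g i)

∑∑-xor : ∀ {m} (f g : Fin m → Fin m → Bool) → ∑∑ (λ i j → f i j xor g i j) ≡ ∑∑ f xor ∑∑ g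
∑∑-xor f g = trans (sum-cong-≗ λ i → ∑-distrib-+ (f i) (g i)) (∑-distrib-+ (sum ∘ f) (sum ∘ g))

∑∑-permute : ∀ {m} (f : Fin m → Fin m → Bool) (π : Perm m) →
             ∑∑ f ≡ ∑∑ (λ i j → f (π ⟨$⟩ʳ i) (π ⟨$⟩ʳ j))
∑∑-permute f π = trans (∑-permute _ π) (sum-cong-≗ λ i → ∑-permute (f (π ⟨$⟩ʳ i)) π)

-- Over 𝔽₂ the off-diagonal terms cancel in pairs.
∑∑-symmetric : ∀ {m} (f : Fin m → Fin m → Bool) →
               (∀ i j → f i j ≡ f j i) → (∀ i → f i i ≡ false) → ∑∑ f ≡ false
∑∑-symmetric {zero} _ _ _ = refl
∑∑-symmetric {suc m} f sym-f diag-f = begin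
  ∑∑ f
    ≡⟨ cong₂ (λ d s → (d xor row) xor s) (diag-f Fin.zero) (∑-distrib-+ column-terms (sum ∘ f′)) ⟩
  row xor (column xor ∑∑ f′)
    ≡⟨ cong (λ c → row xor (c xor ∑∑ f′)) (sum-cong-≗ λ i → sym-f (Fin.suc i) Fin.zero) ⟩
  row xor (row xor ∑∑ f′)
    ≡⟨ xor-assoc row row (∑∑ f′) ⟨
  (row xor row) xor ∑∑ f′
    ≡⟨ cong (_xor ∑∑ f′) (xor-same row) ⟩
  ∑∑ f′
    ≡⟨ ∑∑-symmetric f′ (λ i j → sym-f (Fin.suc i) (Fin.suc j)) (diag-f ∘ Fin.suc) ⟩
  false ∎
  where
  open ≡-Reasoning
  f′ : Fin m → Fin m → Bool
  f′ i j = f (Fin.suc i) (Fin.suc j)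
  column-terms : Fin m → Bool
  column-terms i = f (Fin.suc i) Fin.zero
  row = sum λ j → f Fin.zero (Fin.suc j)
  column = sum column-terms

infix 4 _<ᵇ_
_<ᵇ_ : ∀ {m} → Fin m → Fin m → Bool
i <ᵇ j = does (i <? j)

<ᵇ-irrefl : ∀ {m} (i : Fin m) → (i <ᵇ i) ≡ false
<ᵇ-irrefl i = dec-false (i <? i) (<-irrefl refl)

<ᵇ-flip : ∀ {m} {i j : Fin m} → i ≢ j → (j <ᵇ i) ≡ not (i <ᵇ j)
<ᵇ-flip {i = i} {j} i≢j with <-cmp i j
... | tri< i<j _ _ = trans (dec-false (j <? i) (<-asym i<j)) (cong not (sym (dec-true (i <? j) i<j)))
... | tri≈ _ i≡j _ = contradiction i≡j i≢j
... | tri> _ _ j<i = trans (dec-true (j <? i) j<i) (cong not (sym (dec-false (i <? j) (<-asym j<i))))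

<ᵇ⇒≢ : ∀ {m} {i j : Fin m} → (i <ᵇ j) ≡ true → i ≢ j
<ᵇ⇒≢ {i = i} i<j refl = contradiction (trans (sym i<j) (<ᵇ-irrefl i)) λ ()

perm-injective : ∀ {m} (σ : Perm m) {i j} → σ ⟨$⟩ʳ i ≡ σ ⟨$⟩ʳ j → i ≡ j
perm-injective σ {i} {j} eq = trans (sym (inverseˡ σ)) (trans (cong (σ ⟨$⟩ˡ_) eq) (inverseˡ σ))

inverted : ∀ {m} → Perm m → Fin m → Fin m → Bool
inverted σ i j = (i <ᵇ j) ∧ ((σ ⟨$⟩ʳ j) <ᵇ (σ ⟨$⟩ʳ i))

parity : ∀ {m} → Perm m → Bool
parity σ = ∑∑ (inverted σ)

flips : ∀ {m} → Perm m → Fin m → Fin m → Bool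
flips σ i j = (i <ᵇ j) xor ((σ ⟨$⟩ʳ i) <ᵇ (σ ⟨$⟩ʳ j))

flips-sym : ∀ {m} (σ : Perm m) i j → flips σ i j ≡ flips σ j i
flips-sym σ i j with i Fin.≟ j
... | yes refl = refl
... | no i≢j = sym (trans (cong₂ _xor_ (<ᵇ-flip i≢j) (<ᵇ-flip (i≢j ∘ perm-injective σ)))
                          (xor-annihilates-not (i <ᵇ j) ((σ ⟨$⟩ʳ i) <ᵇ (σ ⟨$⟩ʳ j))))

flips-diag : ∀ {m} (σ : Perm m) i → flips σ i i ≡ false
flips-diag σ i = cong₂ _xor_ (<ᵇ-irrefl i) (<ᵇ-irrefl (σ ⟨$⟩ʳ i))

flips-· : ∀ {m} (σ τ : Perm m) i j → flips (σ · τ) i j ≡ flips τ i j xor flips σ (τ ⟨$⟩ʳ i) (τ ⟨$⟩ʳ j)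
flips-· σ τ i j = sym (xor-telescope (i <ᵇ j) (τi <ᵇ τj) ((σ ⟨$⟩ʳ τi) <ᵇ (σ ⟨$⟩ʳ τj)))
  where
  τi = τ ⟨$⟩ʳ i
  τj = τ ⟨$⟩ʳ j

inverted≡<ᵇ∧flips : ∀ {m} (σ : Perm m) i j → inverted σ i j ≡ (i <ᵇ j) ∧ flips σ i j
inverted≡<ᵇ∧flips σ i j = ∧-guard (i <ᵇ j) λ i<j →
  trans (<ᵇ-flip (<ᵇ⇒≢ i<j ∘ perm-injective σ)) (cong (_xor ((σ ⟨$⟩ʳ i) <ᵇ (σ ⟨$⟩ʳ j))) (sym i<j))

parity≡∑∑flips : ∀ {m} (σ : Perm m) → parity σ ≡ ∑∑ (λ i j → (i <ᵇ j) ∧ flips σ i j)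
parity≡∑∑flips σ = ∑∑-cong (inverted≡<ᵇ∧flips σ)

parity-· : ∀ {m} (σ τ : Perm m) → parity (σ · τ) ≡ parity σ xor parity τ
parity-· σ τ = begin
  parity (σ · τ)
    ≡⟨ parity≡∑∑flips (σ · τ) ⟩
  ∑∑ (λ i j → (i <ᵇ j) ∧ flips (σ · τ) i j)
    ≡⟨ ∑∑-cong (λ i j → trans (cong ((i <ᵇ j) ∧_) (flips-· σ τ i j))
                              (∧-distribˡ-xor (i <ᵇ j) _ _)) ⟩
  ∑∑ (λ i j → (i <ᵇ j) ∧ flips τ i j xor (i <ᵇ j) ∧ flipsσ∘τ i j)
    ≡⟨ ∑∑-xor (λ i j → (i <ᵇ j) ∧ flips τ i j) (λ i j → (i <ᵇ j) ∧ flipsσ∘τ i j) ⟩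
  ∑∑ (λ i j → (i <ᵇ j) ∧ flips τ i j) xor ∑∑ (λ i j → (i <ᵇ j) ∧ flipsσ∘τ i j)
    ≡⟨ cong₂ _xor_ (sym (parity≡∑∑flips τ)) reindex ⟩
  parity τ xor parity σ
    ≡⟨ xor-comm (parity τ) (parity σ) ⟩
  parity σ xor parity τ ∎
  where
  open ≡-Reasoning
  τ< : _ → _ → Bool
  τ< i j = (τ ⟨$⟩ʳ i) <ᵇ (τ ⟨$⟩ʳ j)
  flipsσ∘τ : _ → _ → Bool
  flipsσ∘τ i j = flips σ (τ ⟨$⟩ʳ i) (τ ⟨$⟩ʳ j)
  -- [i < j] and [τ i < τ j] differ exactly on the pairs flipped by τ, which contribute a symmetric sum.
  reindex : ∑∑ (λ i j → (i <ᵇ j) ∧ flipsσ∘τ i j) ≡ parity σ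
  reindex = begin
    ∑∑ (λ i j → (i <ᵇ j) ∧ flipsσ∘τ i j)
      ≡⟨ ∑∑-cong (λ i j → trans (cong (_∧ flipsσ∘τ i j) (sym (xor-recover (i <ᵇ j) (τ< i j))))
                                (∧-distribʳ-xor (flipsσ∘τ i j) (τ< i j) (flips τ i j))) ⟩
    ∑∑ (λ i j → τ< i j ∧ flipsσ∘τ i j xor flips τ i j ∧ flipsσ∘τ i j)
      ≡⟨ ∑∑-xor (λ i j → τ< i j ∧ flipsσ∘τ i j) (λ i j → flips τ i j ∧ flipsσ∘τ i j) ⟩
    ∑∑ (λ i j → τ< i j ∧ flipsσ∘τ i j) xor ∑∑ (λ i j → flips τ i j ∧ flipsσ∘τ i j)
      ≡⟨ cong₂ _xor_ (sym (trans (parity≡∑∑flips σ) (∑∑-permute _ τ)))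
                     (∑∑-symmetric _ (λ i j → cong₂ _∧_ (flips-sym τ i j)
                                                         (flips-sym σ (τ ⟨$⟩ʳ i) (τ ⟨$⟩ʳ j)))
                                     (λ i → cong (_∧ flipsσ∘τ i i) (flips-diag τ i))) ⟩
    parity σ xor false
      ≡⟨ xor-identityʳ (parity σ) ⟩
    parity σ ∎

parity-resp-≈ : ∀ {m} {σ τ : Perm m} → σ ≈ τ → parity σ ≡ parity τ
parity-resp-≈ σ≈τ = ∑∑-cong λ i j → cong₂ (λ x y → (i <ᵇ j) ∧ (x <ᵇ y)) (σ≈τ j) (σ≈τ i)

parity-one : ∀ {m} → parity (one {m}) ≡ false
parity-one {m} = trans (parity-· (one {m}) one) (xor-same (parity (one {m})))

parity-inv : ∀ {m} (σ : Perm m) → parity (inv σ) ≡ parity σ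
parity-inv {m} σ = xor-cancel (parity σ) (parity (inv σ))
  (trans (sym (parity-· σ (inv σ)))
         (trans (parity-resp-≈ {σ = σ · inv σ} {one} (λ _ → inverseʳ σ)) (parity-one {m})))

odd : ℕ → Bool
odd zero = false
odd (suc k) = not (odd k)

odd-*2 : ∀ q → odd (q * 2) ≡ false
odd-*2 zero = refl
odd-*2 (suc q) = cong (not ∘ not) (odd-*2 q)

xorMap : ∀ {A : Set} → (A → Bool) → List A → Bool
xorMap h = foldr (λ x b → h x xor b) false

odd-length-filter : ∀ {A : Set} {P : A → Set} (P? : Decidable P) xs →
                    odd (length (filter P? xs)) ≡ xorMap (does ∘ P?) xs
odd-length-filter P? [] = refl
odd-length-filter P? (x ∷ xs) with does (P? x)
... | false = odd-length-filter P? xs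
... | true = cong not (odd-length-filter P? xs)

xorMap-++ : ∀ {A : Set} (h : A → Bool) xs ys → xorMap h (xs ++ ys) ≡ xorMap h xs xor xorMap h ys
xorMap-++ h [] ys = refl
xorMap-++ h (x ∷ xs) ys = trans (cong (h x xor_) (xorMap-++ h xs ys)) (sym (xor-assoc (h x) _ _))

xorMap-map : ∀ {A B : Set} (h : B → Bool) (f : A → B) xs → xorMap h (map f xs) ≡ xorMap (h ∘ f) xs
xorMap-map h f [] = refl
xorMap-map h f (x ∷ xs) = cong (h (f x) xor_) (xorMap-map h f xs)

xorMap-cartesianProduct : ∀ {A B : Set} (h : A × B → Bool) xs ys →
  xorMap h (cartesianProduct xs ys) ≡ xorMap (λ x → xorMap (λ y → h (x , y)) ys) xs
xorMap-cartesianProduct h [] ys = refl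
xorMap-cartesianProduct h (x ∷ xs) ys = trans (xorMap-++ h (map (x ,_) ys) (cartesianProduct xs ys))
  (cong₂ _xor_ (xorMap-map h (x ,_) ys) (xorMap-cartesianProduct h xs ys))

xorMap-tabulate : ∀ {A : Set} {m} (h : A → Bool) (f : Fin m → A) → xorMap h (tabulate f) ≡ sum (h ∘ f)
xorMap-tabulate {m = zero} h f = refl
xorMap-tabulate {m = suc m} h f = cong (h (f Fin.zero) xor_) (xorMap-tabulate h (f ∘ Fin.suc))

odd-inversions : ∀ {m} (σ : Perm m) → odd (inversions σ) ≡ parity σ
odd-inversions {m} σ = begin
  odd (inversions σ)
    ≡⟨ odd-length-filter _ (cartesianProduct (allFin m) (allFin m)) ⟩
  xorMap (λ (i , j) → inverted σ i j) (cartesianProduct (allFin m) (allFin m))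
    ≡⟨ xorMap-cartesianProduct (λ (i , j) → inverted σ i j) (allFin m) (allFin m) ⟩
  xorMap (λ i → xorMap (inverted σ i) (allFin m)) (allFin m)
    ≡⟨ xorMap-tabulate (λ i → xorMap (inverted σ i) (allFin m)) id ⟩
  sum (λ i → xorMap (inverted σ i) (allFin m))
    ≡⟨ sum-cong-≗ (λ i → xorMap-tabulate (inverted σ i) id) ⟩
  parity σ ∎
  where open ≡-Reasoning

even⇒parity≡false : ∀ {m} {σ : Perm m} → IsEven σ → parity σ ≡ false
even⇒parity≡false {σ = σ} (divides q eq) = trans (sym (odd-inversions σ)) (trans (cong odd eq) (odd-*2 q))

swapℕ : ℕ → ℕ → ℕ → ℕ
swapℕ p q x = if does (x ℕ.≟ p) then q else if does (x ℕ.≟ q) then p else x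

swapℕ-suc : ∀ p q x → swapℕ (suc p) (suc q) (suc x) ≡ suc (swapℕ p q x)
swapℕ-suc p q x with does (x ℕ.≟ p)
... | true = refl
... | false with does (x ℕ.≟ q)
...   | true = refl
...   | false = refl

swapℕ-matchˡ : ∀ p q → swapℕ p q p ≡ q
swapℕ-matchˡ p q rewrite dec-true (p ℕ.≟ p) refl = refl

swapℕ-fixes-above : ∀ {p q x} → p < x → q < x → swapℕ p q x ≡ x
swapℕ-fixes-above {p} {q} {x} p<x q<x
  rewrite dec-false (x ℕ.≟ p) (>⇒≢ p<x) | dec-false (x ℕ.≟ q) (>⇒≢ q<x) = refl

toℕ-transpose : ∀ {m} (i j k : Fin m) → toℕ (PC.transpose i j k) ≡ swapℕ (toℕ i) (toℕ j) (toℕ k)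
toℕ-transpose i j k with k Fin.≟ i
... | yes refl rewrite dec-true (toℕ k ℕ.≟ toℕ k) refl = refl
... | no k≢i rewrite dec-false (toℕ k ℕ.≟ toℕ i) (k≢i ∘ toℕ-injective) with k Fin.≟ j
...   | yes refl rewrite dec-true (toℕ k ℕ.≟ toℕ k) refl = refl
...   | no k≢j rewrite dec-false (toℕ k ℕ.≟ toℕ j) (k≢j ∘ toℕ-injective) = refl

tr≡transpose : ∀ {m p q} (p<m : p < m) (q<m : q < m) → tr m p q ≡ transpose (fromℕ< p<m) (fromℕ< q<m)
tr≡transpose {m} {p} {q} p<m q<m with p ℕ.<? m | q ℕ.<? m
... | yes _ | yes _ = refl  -- fromℕ< takes its bound irrelevantly
... | no p≮m | _ = contradiction p<m p≮m
... | yes _ | no q≮m = contradiction q<m q≮m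

tr-apply : ∀ {m p q} → p < m → q < m → ∀ k → toℕ (tr m p q ⟨$⟩ʳ k) ≡ swapℕ p q (toℕ k)
tr-apply p<m q<m k rewrite tr≡transpose p<m q<m =
  trans (toℕ-transpose _ _ k) (cong₂ (λ p q → swapℕ p q (toℕ k)) (toℕ-fromℕ< p<m) (toℕ-fromℕ< q<m))

tr-unapply : ∀ {m p q} → p < m → q < m → ∀ k → toℕ (tr m p q ⟨$⟩ˡ k) ≡ swapℕ q p (toℕ k)
tr-unapply p<m q<m k rewrite tr≡transpose p<m q<m =
  trans (toℕ-transpose _ _ k) (cong₂ (λ q p → swapℕ q p (toℕ k)) (toℕ-fromℕ< q<m) (toℕ-fromℕ< p<m))

does-<?-asym : ∀ x y → does (x ℕ.<? y) ∧ does (y ℕ.<? x) ≡ false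
does-<?-asym zero zero = refl
does-<?-asym zero (suc y) = refl
does-<?-asym (suc x) zero = refl
does-<?-asym (suc x) (suc y) = does-<?-asym x y

swapℕ-adjacent-inverts : ∀ p x y → let s = swapℕ p (suc p) in
  does (x ℕ.<? y) ∧ does (s y ℕ.<? s x) ≡ does (x ℕ.≟ p) ∧ does (y ℕ.≟ suc p)
swapℕ-adjacent-inverts zero zero zero = refl
swapℕ-adjacent-inverts zero zero (suc zero) = refl
swapℕ-adjacent-inverts zero zero (suc (suc y)) = refl
swapℕ-adjacent-inverts zero (suc zero) zero = refl
swapℕ-adjacent-inverts zero (suc zero) (suc zero) = refl
swapℕ-adjacent-inverts zero (suc zero) (suc (suc y)) = refl
swapℕ-adjacent-inverts zero (suc (suc x)) zero = refl
swapℕ-adjacent-inverts zero (suc (suc x)) (suc zero) = refl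
swapℕ-adjacent-inverts zero (suc (suc x)) (suc (suc y)) = does-<?-asym x y
swapℕ-adjacent-inverts (suc p) zero zero = refl
swapℕ-adjacent-inverts (suc p) zero (suc y) = refl
swapℕ-adjacent-inverts (suc p) (suc x) zero = sym (∧-zeroʳ _)
swapℕ-adjacent-inverts (suc p) (suc x) (suc y)
  rewrite swapℕ-suc p (suc p) x | swapℕ-suc p (suc p) y = swapℕ-adjacent-inverts p x y

∑-indicator : ∀ {m p} → p < m → sum {m} (λ i → does (toℕ i ℕ.≟ p)) ≡ true
∑-indicator {suc m} {zero} _ = cong (true xor_) (sum-replicate-zero m)
∑-indicator {suc m} {suc p} (s≤s p<m) = ∑-indicator p<m

parity-adjacent-transposition : ∀ {m p} → suc p < m → parity (tr m p (suc p)) ≡ true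
parity-adjacent-transposition {m} {p} p+1<m = begin
  parity t
    ≡⟨ ∑∑-cong inverted-t ⟩
  ∑∑ (λ i j → δ p i ∧ δ (suc p) j)
    ≡⟨ sum-cong-≗ (λ i → sym (*-distribˡ-sum (δ p i) (δ (suc p)))) ⟩
  sum (λ i → δ p i ∧ sum (δ (suc p)))
    ≡⟨ sum-cong-≗ (λ i → trans (cong (δ p i ∧_) (∑-indicator p+1<m)) (∧-identityʳ (δ p i))) ⟩
  sum (δ p)
    ≡⟨ ∑-indicator p<m ⟩
  true ∎
  where
  open ≡-Reasoning
  p<m = <-trans (n<1+n p) p+1<m
  t = tr m p (suc p)
  δ : ℕ → Fin m → Bool
  δ q i = does (toℕ i ℕ.≟ q)
  inverted-t : ∀ i j → inverted t i j ≡ δ p i ∧ δ (suc p) j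
  inverted-t i j rewrite tr-apply p<m p+1<m i | tr-apply p<m p+1<m j =
    swapℕ-adjacent-inverts p (toℕ i) (toℕ j)

≈-setoid : ℕ → Setoid _ _
≈-setoid m = record
  { Carrier = Perm m
  ; _≈_ = _≈_
  ; isEquivalence = record
    { refl = λ _ → refl
    ; sym = λ σ≈τ i → sym (σ≈τ i)
    ; trans = λ σ≈τ τ≈ρ i → trans (σ≈τ i) (τ≈ρ i)
    }
  }

⟨$⟩ˡ-resp-≈ : ∀ {m} (σ τ : Perm m) → σ ≈ τ → ∀ c → σ ⟨$⟩ˡ c ≡ τ ⟨$⟩ˡ c
⟨$⟩ˡ-resp-≈ σ τ σ≈τ c =
  trans (sym (inverseˡ τ)) (cong (τ ⟨$⟩ˡ_) (trans (sym (σ≈τ (σ ⟨$⟩ˡ c))) (inverseʳ σ)))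

record FixesAbove {m} (t : ℕ) (σ : Perm m) : Set where
  constructor fixesAbove
  field fixes : ∀ i → t < toℕ i → σ ⟨$⟩ʳ i ≡ i
open FixesAbove

module _ {m : ℕ} {t : ℕ} where

  FixesAbove-· : {σ τ : Perm m} → FixesAbove t σ → FixesAbove t τ → FixesAbove t (σ · τ)
  FixesAbove-· {σ} σ-fix τ-fix = fixesAbove λ i t<i →
    trans (cong (σ ⟨$⟩ʳ_) (fixes τ-fix i t<i)) (fixes σ-fix i t<i)

  FixesAbove-inv : {σ : Perm m} → FixesAbove t σ → FixesAbove t (inv σ)
  FixesAbove-inv {σ} σ-fix = fixesAbove λ i t<i →
    trans (cong (σ ⟨$⟩ˡ_) (sym (fixes σ-fix i t<i))) (inverseˡ σ)

  FixesAbove-resp-≈ : {σ τ : Perm m} → σ ≈ τ → FixesAbove t σ → FixesAbove t τ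
  FixesAbove-resp-≈ σ≈τ σ-fix = fixesAbove λ i t<i → trans (sym (σ≈τ i)) (fixes σ-fix i t<i)

  FixesAbove-mono : ∀ {s} {σ : Perm m} → s ≤ t → FixesAbove s σ → FixesAbove t σ
  FixesAbove-mono s≤t σ-fix = fixesAbove λ i t<i → fixes σ-fix i (≤-<-trans s≤t t<i)

  -- If σ i lay above t then σ would fix it, forcing σ i = i.
  FixesAbove-bounded : {σ : Perm m} → FixesAbove t σ → ∀ i → toℕ i ≤ t → toℕ (σ ⟨$⟩ʳ i) ≤ t
  FixesAbove-bounded {σ} σ-fix i i≤t with toℕ (σ ⟨$⟩ʳ i) ℕ.≤? t
  ... | yes σi≤t = σi≤t
  ... | no σi≰t =
    subst (λ j → toℕ j ≤ t) (sym (perm-injective σ (fixes σ-fix (σ ⟨$⟩ʳ i) (≰⇒> σi≰t)))) i≤t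

  FixesAbove-lower : {σ : Perm m} → FixesAbove (suc t) σ →
                     ∀ c → toℕ c ≡ suc t → σ ⟨$⟩ʳ c ≡ c → FixesAbove t σ
  FixesAbove-lower {σ} σ-fix c c≡1+t σc≡c = fixesAbove λ i t<i → lower i t<i
    where
    lower : ∀ i → t < toℕ i → σ ⟨$⟩ʳ i ≡ i
    lower i t<i with toℕ i ℕ.≟ suc t
    ... | yes i≡1+t = subst (λ j → σ ⟨$⟩ʳ j ≡ j) (toℕ-injective (trans c≡1+t (sym i≡1+t))) σc≡c
    ... | no i≢1+t = fixes σ-fix i (≤∧≢⇒< t<i (i≢1+t ∘ sym))

FixesAbove-all : ∀ {t} (σ : Perm (suc t)) → FixesAbove t σ
FixesAbove-all σ = fixesAbove λ i t<i → contradiction t<i (≤⇒≯ (ℕ.s≤s⁻¹ (toℕ<n i)))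

-- σ ∈ A_{t+1}, acting on the points 0, …, t.
record Alt {m} (t : ℕ) (σ : Perm m) : Set where
  field
    fixing : FixesAbove t σ
    even : parity σ ≡ false
open Alt

module _ {m : ℕ} {t : ℕ} where

  Alt-one : Alt t (one {m})
  Alt-one = record { fixing = fixesAbove λ _ _ → refl ; even = parity-one {m} }

  Alt-· : {σ τ : Perm m} → Alt t σ → Alt t τ → Alt t (σ · τ)
  Alt-· {σ} {τ} σ∈A τ∈A = record
    { fixing = FixesAbove-· (fixing σ∈A) (fixing τ∈A)
    ; even = trans (parity-· σ τ) (cong₂ _xor_ (even σ∈A) (even τ∈A))
    }

  Alt-inv : {σ : Perm m} → Alt t σ → Alt t (inv σ)
  Alt-inv {σ} σ∈A = record
    { fixing = FixesAbove-inv (fixing σ∈A)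
    ; even = trans (parity-inv σ) (even σ∈A)
    }

  Alt-resp-≈ : {σ τ : Perm m} → σ ≈ τ → Alt t σ → Alt t τ
  Alt-resp-≈ {σ} {τ} σ≈τ σ∈A = record
    { fixing = FixesAbove-resp-≈ σ≈τ (fixing σ∈A)
    ; even = trans (sym (parity-resp-≈ {σ = σ} {τ} σ≈τ)) (even σ∈A)
    }

  Alt-mono : ∀ {s} {σ : Perm m} → s ≤ t → Alt s σ → Alt t σ
  Alt-mono s≤t σ∈A = record { fixing = FixesAbove-mono s≤t (fixing σ∈A) ; even = even σ∈A }

Alt-lower : ∀ {m t} {σ : Perm m} → Alt (suc t) σ → ∀ c → toℕ c ≡ suc t → σ ⟨$⟩ʳ c ≡ c → Alt t σ
Alt-lower σ∈A c c≡1+t σc≡c = record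
  { fixing = FixesAbove-lower (Alt.fixing σ∈A) c c≡1+t σc≡c ; even = Alt.even σ∈A }

FixesAbove₁-cases : ∀ {m} (σ : Perm (suc (suc m))) → FixesAbove 1 σ → σ ≈ one ⊎ σ ≈ tr (suc (suc m)) 0 1
FixesAbove₁-cases σ σ-fix with σ ⟨$⟩ʳ 0F in σ0 | σ ⟨$⟩ʳ 1F in σ1
... | 0F | 1F = inj₁ λ { 0F → σ0 ; 1F → σ1 ; (Fin.suc (Fin.suc _)) → fixes σ-fix _ (s≤s (s≤s z≤n)) }
... | 1F | 0F = inj₂ λ { 0F → σ0 ; 1F → σ1 ; (Fin.suc (Fin.suc _)) → fixes σ-fix _ (s≤s (s≤s z≤n)) }
... | 0F | 0F = contradiction (perm-injective σ (trans σ0 (sym σ1))) λ ()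
... | 1F | 1F = contradiction (perm-injective σ (trans σ0 (sym σ1))) λ ()
... | Fin.suc (Fin.suc _) | _ =
  contradiction (perm-injective σ (trans σ0 (sym (fixes σ-fix _ (s≤s (s≤s z≤n)))))) λ ()
... | _ | Fin.suc (Fin.suc _) =
  contradiction (perm-injective σ (trans σ1 (sym (fixes σ-fix _ (s≤s (s≤s z≤n)))))) λ ()

Alt₁⇒≈one : ∀ {m} {σ : Perm (suc (suc m))} → Alt 1 σ → σ ≈ one
Alt₁⇒≈one {m} {σ} σ∈A with FixesAbove₁-cases σ (fixing σ∈A)
... | inj₁ σ≈one = σ≈one
... | inj₂ σ≈t₀₁ with () ← trans (sym (parity-adjacent-transposition {suc (suc m)} (s≤s (s≤s z≤n))))
                                (trans (parity-resp-≈ {σ = tr _ 0 1} {σ} (λ i → sym (σ≈t₀₁ i))) (even σ∈A))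

module _ {n l : ℕ} (l+2≤n : suc (suc l) ≤ n) where

  private
    0<m : 0 < suc n
    0<m = s≤s z≤n
    1<m : 1 < suc n
    1<m = s≤s (≤-trans (s≤s z≤n) l+2≤n)
    l+1<m : suc l < suc n
    l+1<m = s≤s (≤-trans (n≤1+n _) l+2≤n)
    l+2<m : suc (suc l) < suc n
    l+2<m = s≤s l+2≤n

  a-apply : ∀ x → toℕ (a n l ⟨$⟩ʳ x) ≡ swapℕ 0 1 (swapℕ (suc l) (suc (suc l)) (toℕ x))
  a-apply x = trans (tr-apply 0<m 1<m _) (cong (swapℕ 0 1) (tr-apply l+1<m l+2<m x))

  a-unapply : ∀ x → toℕ (a n l ⟨$⟩ˡ x) ≡ swapℕ (suc (suc l)) (suc l) (swapℕ 1 0 (toℕ x))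
  a-unapply x = trans (tr-unapply l+1<m l+2<m _) (cong (swapℕ (suc (suc l)) (suc l)) (tr-unapply 0<m 1<m x))

  Alt-a : Alt (suc (suc l)) (a n l)
  Alt-a = record
    { fixing = fixesAbove λ i l+2<i →
        let 1<i = ≤-<-trans (s≤s z≤n) l+2<i in
        toℕ-injective (trans (a-apply i)
          (trans (cong (swapℕ 0 1) (swapℕ-fixes-above (<-trans (n<1+n _) l+2<i) l+2<i))
                 (swapℕ-fixes-above (<-trans (s≤s z≤n) 1<i) 1<i)))
    ; even = trans (parity-· (tr (suc n) 0 1) (tr (suc n) (suc l) (suc (suc l))))
                   (cong₂ _xor_ (parity-adjacent-transposition 1<m) (parity-adjacent-transposition l+2<m))
    }

  a-unapply-l+2 : ∀ c → toℕ c ≡ suc (suc l) → toℕ (a n l ⟨$⟩ˡ c) ≡ suc l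
  a-unapply-l+2 c c≡l+2 rewrite a-unapply c | c≡l+2 = swapℕ-matchˡ (suc (suc l)) (suc l)

a₀-apply-two : ∀ {n} → 2 ≤ n → ∀ x → toℕ x ≡ 2 → toℕ (a n 0 ⟨$⟩ʳ x) ≡ 0
a₀-apply-two 2≤n x x≡2 rewrite a-apply 2≤n x | x≡2 = refl

module _ {n k : ℕ} (k+2≤n : suc (suc k) ≤ n) where

  private
    Alt-a≤ : ∀ {l} → l ≤ k → Alt (suc (suc k)) (a n l)
    Alt-a≤ l≤k = Alt-mono (s≤s (s≤s l≤k)) (Alt-a (≤-trans (s≤s (s≤s l≤k)) k+2≤n))

    Alt-descs : ∀ j → j ≤ k → All (Alt (suc (suc k))) (descs (a n) j)
    Alt-descs zero _ = Alt-a≤ z≤n ∷ []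
    Alt-descs (suc j) j+1≤k =
      Alt-a≤ j+1≤k ∷ All.map⁺ (All.map (Alt-· (Alt-a≤ j+1≤k))
                                       (Alt-descs j (≤-trans (n≤1+n j) j+1≤k)))

    Alt-top : ∀ j → j ≤ k → Alt (suc (suc k)) (top (a n) j)
    Alt-top zero _ = Alt-one
    Alt-top (suc j) j+1≤k = Alt-· (Alt-a≤ j+1≤k) (Alt-top j (≤-trans (n≤1+n j) j+1≤k))

  Alt-R : All (Alt (suc (suc k))) (R n k)
  Alt-R = Alt-one ∷ All.++⁺ (Alt-descs k ≤-refl)
                             (Alt-· (Alt-top k ≤-refl) (Alt-inv (Alt-a≤ z≤n)) ∷ [])

  ∈ᴾ-R⇒Alt : ∀ {σ} → σ ∈ᴾ R n k → Alt (suc (suc k)) σ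
  ∈ᴾ-R⇒Alt = All.lookupₛ (≈-setoid (suc n)) Alt-resp-≈ Alt-R

preimage : ∀ {m} → Fin m → Perm m → ℕ
preimage c σ = toℕ (σ ⟨$⟩ˡ c)

descs-preimages : ∀ {n} j → suc (suc j) ≤ n → ∀ c → toℕ c ≡ suc (suc j) →
                  map (preimage c) (descs (a n) j) ≡ applyDownFrom suc (suc j)
descs-preimages zero j+2≤n c c≡j+2 = cong (_∷ []) (a-unapply-l+2 j+2≤n c c≡j+2)
descs-preimages {n} (suc j) j+3≤n c c≡j+3 = cong₂ _∷_ (a-unapply-l+2 j+3≤n c c≡j+3) (begin
  map (preimage c) (map (a n (suc j) ·_) (descs (a n) j))
    ≡⟨ map-∘ (descs (a n) j) ⟨
  map (preimage (a n (suc j) ⟨$⟩ˡ c)) (descs (a n) j)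
    ≡⟨ descs-preimages j (≤-trans (n≤1+n _) j+3≤n) _ (a-unapply-l+2 j+3≤n c c≡j+3) ⟩
  applyDownFrom suc (suc j) ∎)
  where open ≡-Reasoning

top-preimage : ∀ {n} j → suc (suc j) ≤ n → ∀ c → toℕ c ≡ suc (suc j) → preimage c (top (a n) j) ≡ 2
top-preimage zero _ c c≡2 = c≡2
top-preimage (suc j) j+3≤n c c≡j+3 =
  top-preimage j (≤-trans (n≤1+n _) j+3≤n) _ (a-unapply-l+2 j+3≤n c c≡j+3)

R-preimages : ∀ {n} k → suc (suc k) ≤ n → ∀ c → toℕ c ≡ suc (suc k) →
              map (preimage c) (R n k) ≡ downFrom (suc (suc (suc k)))
R-preimages {n} k k+2≤n c c≡k+2 = cong₂ _∷_ c≡k+2 (begin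
  map (preimage c) (descs (a n) k ++ r-last ∷ [])
    ≡⟨ map-++ (preimage c) (descs (a n) k) (r-last ∷ []) ⟩
  map (preimage c) (descs (a n) k) ++ preimage c r-last ∷ []
    ≡⟨ cong₂ (λ xs x → xs ++ x ∷ []) (descs-preimages k k+2≤n c c≡k+2)
             (a₀-apply-two (≤-trans (s≤s (s≤s z≤n)) k+2≤n) _ (top-preimage k k+2≤n c c≡k+2)) ⟩
  applyDownFrom suc (suc k) ++ 0 ∷ []
    ≡⟨ downFrom-∷ʳ (suc k) ⟩
  downFrom (suc (suc k)) ∎)
  where
  open ≡-Reasoning
  r-last = top (a n) k · inv (a n 0)

module _ {m : ℕ} {B : Set} (g : Perm m → B) (g-resp : ∀ σ τ → σ ≈ τ → g σ ≡ g τ) where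

  ∈-map⇒∈ᴾ : ∀ {b xs} → b ∈ map g xs → ∃[ σ ] σ ∈ᴾ xs × g σ ≡ b
  ∈-map⇒∈ᴾ b∈ with σ , σ∈ , b≡gσ ← Membershipₛ.∈-map⁻ (≈-setoid m) (setoid B) b∈ =
    σ , σ∈ , sym b≡gσ

  private
    ≢g-resp : ∀ {b σ τ} → σ ≈ τ → b ≢ g σ → b ≢ g τ
    ≢g-resp σ≈τ b≢gσ b≡gτ = b≢gσ (trans b≡gτ (sym (g-resp _ _ σ≈τ)))

  Unique-map⇒injective : ∀ {σ τ xs} → Unique (map g xs) → σ ∈ᴾ xs → τ ∈ᴾ xs → g σ ≡ g τ → σ ≈ τ
  Unique-map⇒injective _ (here σ≈x) (here τ≈x) _ i = trans (σ≈x i) (sym (τ≈x i))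
  Unique-map⇒injective (gx∉ ∷ _) (here σ≈x) (there τ∈) gσ≡gτ =
    contradiction (trans (sym (g-resp _ _ σ≈x)) gσ≡gτ)
                  (All.lookupₛ (≈-setoid m) ≢g-resp (All.map⁻ gx∉) τ∈)
  Unique-map⇒injective (gx∉ ∷ _) (there σ∈) (here τ≈x) gσ≡gτ =
    contradiction (trans (sym (g-resp _ _ τ≈x)) (sym gσ≡gτ))
                  (All.lookupₛ (≈-setoid m) ≢g-resp (All.map⁻ gx∉) σ∈)
  Unique-map⇒injective (_ ∷ g-unique) (there σ∈) (there τ∈) = Unique-map⇒injective g-unique σ∈ τ∈

preimage-resp-≈ : ∀ {m} (c : Fin m) (σ τ : Perm m) → σ ≈ τ → preimage c σ ≡ preimage c τ
preimage-resp-≈ c σ τ σ≈τ = cong toℕ (⟨$⟩ˡ-resp-≈ σ τ σ≈τ c)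

module _ {n k : ℕ} (k+2≤n : suc (suc k) ≤ n) (c : Fin (suc n)) (c≡k+2 : toℕ c ≡ suc (suc k)) where

  R-preimage-onto : ∀ y → toℕ y ≤ suc (suc k) → ∃[ r ] r ∈ᴾ R n k × r ⟨$⟩ˡ c ≡ y
  R-preimage-onto y y≤k+2
    with r , r∈R , r⁻¹c≡y ← ∈-map⇒∈ᴾ (preimage c) (preimage-resp-≈ c)
           (subst (toℕ y ∈_) (sym (R-preimages k k+2≤n c c≡k+2)) (∈-downFrom⁺ (s≤s y≤k+2)))
    = r , r∈R , toℕ-injective r⁻¹c≡y

  R-preimage-injective : ∀ {r r′} → r ∈ᴾ R n k → r′ ∈ᴾ R n k → r ⟨$⟩ˡ c ≡ r′ ⟨$⟩ˡ c → r ≈ r′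
  R-preimage-injective {r} {r′} r∈R r′∈R eq =
    Unique-map⇒injective (preimage c) (preimage-resp-≈ c) {r} {r′}
    (subst Unique (sym (R-preimages k k+2≤n c c≡k+2)) (downFrom⁺ _)) r∈R r′∈R (cong toℕ eq)

infixl 5 _∷ʳ_
_∷ʳ_ : ∀ {A : Set} {k} → Vector A k → A → Vector A (suc k)
_∷ʳ_ {k = zero} _ r _ = r
_∷ʳ_ {k = suc k} w r Fin.zero = w Fin.zero
_∷ʳ_ {k = suc k} w r (Fin.suc j) = ((w ∘ Fin.suc) ∷ʳ r) j

∷ʳ⁺ : ∀ {A : Set} (P : ℕ → A → Set) {k} {w : Vector A k} {r} →
      (∀ j → P (toℕ j) (w j)) → P k r → ∀ j → P (toℕ j) ((w ∷ʳ r) j)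
∷ʳ⁺ P {zero} _ Pr Fin.zero = Pr
∷ʳ⁺ P {suc k} Pw Pr Fin.zero = Pw Fin.zero
∷ʳ⁺ P {suc k} Pw Pr (Fin.suc j) = ∷ʳ⁺ (P ∘ suc) (Pw ∘ Fin.suc) Pr j

module _ {A : Set} (P : ℕ → A → Set) {k} {w : Vector A (suc k)} (Pw : ∀ j → P (toℕ j) (w j)) where

  init⁺ : ∀ j → P (toℕ j) (init w j)
  init⁺ j = subst (λ i → P i (init w j)) (toℕ-inject₁ j) (Pw (inject₁ j))

  last⁺ : P k (last w)
  last⁺ = subst (λ i → P i (last w)) (toℕ-fromℕ k) (Pw (fromℕ k))

init-last⇒pointwise : ∀ {A : Set} {Q : A → A → Set} {k} {w w′ : Vector A (suc k)} →
  (∀ j → Q (init w j) (init w′ j)) → Q (last w) (last w′) → ∀ j → Q (w j) (w′ j)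
init-last⇒pointwise {k = zero} _ Qlast Fin.zero = Qlast
init-last⇒pointwise {k = suc k} Qinit _ Fin.zero = Qinit Fin.zero
init-last⇒pointwise {Q = Q} {k = suc k} Qinit Qlast (Fin.suc j) =
  init-last⇒pointwise {Q = Q} (Qinit ∘ Fin.suc) Qlast j

module _ {m : ℕ} where

  prod-∷ʳ : ∀ {k} (w : Vector (Perm m) k) r → prod (w ∷ʳ r) ≈ prod w · r
  prod-∷ʳ {zero} w r x = refl
  prod-∷ʳ {suc k} w r x = cong (w Fin.zero ⟨$⟩ʳ_) (prod-∷ʳ (w ∘ Fin.suc) r x)

  prod-init-last : ∀ {k} (w : Vector (Perm m) (suc k)) → prod w ≈ prod (init w) · last w
  prod-init-last {zero} w x = refl
  prod-init-last {suc k} w x = cong (w Fin.zero ⟨$⟩ʳ_) (prod-init-last (w ∘ Fin.suc) x)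

  prod-FixesAbove : ∀ {t k} (w : Vector (Perm m) k) → (∀ j → FixesAbove t (w j)) → FixesAbove t (prod w)
  prod-FixesAbove {k = zero} w _ = fixesAbove λ _ _ → refl
  prod-FixesAbove {k = suc k} w w-fix =
    FixesAbove-· (w-fix Fin.zero) (prod-FixesAbove (w ∘ Fin.suc) (w-fix ∘ Fin.suc))

  ·-cancelʳ : ∀ {σ τ : Perm m} ρ → σ · ρ ≈ τ · ρ → σ ≈ τ
  ·-cancelʳ {σ} {τ} ρ σρ≈τρ x = begin
    σ ⟨$⟩ʳ x                ≡⟨ cong (σ ⟨$⟩ʳ_) (inverseʳ ρ) ⟨
    σ ⟨$⟩ʳ (ρ ⟨$⟩ʳ (ρ ⟨$⟩ˡ x)) ≡⟨ σρ≈τρ (ρ ⟨$⟩ˡ x) ⟩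
    τ ⟨$⟩ʳ (ρ ⟨$⟩ʳ (ρ ⟨$⟩ˡ x)) ≡⟨ cong (τ ⟨$⟩ʳ_) (inverseʳ ρ) ⟩
    τ ⟨$⟩ʳ x                ∎
    where open ≡-Reasoning

InR : ∀ n → ℕ → Perm (suc n) → Set
InR n t σ = σ ∈ᴾ R n t

Factors : ∀ n {k} → Vector (Perm (suc n)) k → Set
Factors n w = ∀ j → InR n (toℕ j) (w j)

module _ {n : ℕ} where

  Factors⇒FixesAbove : ∀ {k} {w : Vector (Perm (suc n)) k} → k < n → Factors n w →
                       FixesAbove (suc k) (prod w)
  Factors⇒FixesAbove k<n w∈R = prod-FixesAbove _ λ j →
    FixesAbove-mono (s≤s (toℕ<n j)) (Alt.fixing (∈ᴾ-R⇒Alt (≤-trans (s≤s (toℕ<n j)) k<n) (w∈R j)))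

  last-factor-preimage : ∀ {k} {w : Vector (Perm (suc n)) (suc k)} → suc k < n → Factors n w →
    ∀ c → toℕ c ≡ suc (suc k) → last w ⟨$⟩ˡ c ≡ prod w ⟨$⟩ˡ c
  last-factor-preimage {k} {w} k+1<n w∈R c c≡k+2 = begin
    last w ⟨$⟩ˡ c
      ≡⟨ cong (last w ⟨$⟩ˡ_) (FixesAbove.fixes (FixesAbove-inv init-fix) c (≤-reflexive (sym c≡k+2))) ⟨
    last w ⟨$⟩ˡ (prod (init w) ⟨$⟩ˡ c)
      ≡⟨ ⟨$⟩ˡ-resp-≈ (prod w) (prod (init w) · last w) (prod-init-last w) c ⟨
    prod w ⟨$⟩ˡ c ∎
    where
    open ≡-Reasoning
    init-fix : FixesAbove (suc k) (prod (init w))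
    init-fix = Factors⇒FixesAbove (≤-trans (n≤1+n _) k+1<n) (init⁺ (InR n) {w = w} w∈R)

factorise : ∀ {n} k → k < n → (v : Perm (suc n)) → Alt (suc k) v →
            ∃[ w ] Factors n {k} w × v ≈ prod w
factorise {suc n} zero _ v v∈A = (λ ()) , (λ ()) , Alt₁⇒≈one v∈A
factorise {n} (suc k) k+1<n v v∈A = w ∷ʳ r , ∷ʳ⁺ (InR n) w∈R r∈R , v≈wr
  where
  c = fromℕ< (s≤s k+1<n)
  c≡k+2 = toℕ-fromℕ< (s≤s k+1<n)
  hit = R-preimage-onto k+1<n c c≡k+2 (v ⟨$⟩ˡ c)
          (FixesAbove-bounded (FixesAbove-inv (Alt.fixing v∈A)) c (≤-reflexive c≡k+2))
  r = proj₁ hit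
  r∈R = proj₁ (proj₂ hit)
  h = v · inv r
  h∈A : Alt (suc k) h
  h∈A = Alt-lower (Alt-· v∈A (Alt-inv (∈ᴾ-R⇒Alt k+1<n {r} r∈R))) c c≡k+2
                  (trans (cong (v ⟨$⟩ʳ_) (proj₂ (proj₂ hit))) (inverseʳ v))
  rest = factorise k (≤-trans (n≤1+n _) k+1<n) h h∈A
  w = proj₁ rest
  w∈R = proj₁ (proj₂ rest)
  v≈wr : v ≈ prod (w ∷ʳ r)
  v≈wr x = begin
    v ⟨$⟩ʳ x                ≡⟨ cong (v ⟨$⟩ʳ_) (inverseˡ r) ⟨
    h ⟨$⟩ʳ (r ⟨$⟩ʳ x)         ≡⟨ proj₂ (proj₂ rest) (r ⟨$⟩ʳ x) ⟩
    prod w ⟨$⟩ʳ (r ⟨$⟩ʳ x)    ≡⟨ prod-∷ʳ w r x ⟨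
    prod (w ∷ʳ r) ⟨$⟩ʳ x ∎
    where open ≡-Reasoning

factorisation-unique : ∀ {n} k → k < n → {w w′ : Vector (Perm (suc n)) k} →
  Factors n w → Factors n w′ → prod w ≈ prod w′ → ∀ j → w j ≈ w′ j
factorisation-unique zero _ _ _ _ ()
factorisation-unique {n} (suc k) k+1<n {w} {w′} w∈R w′∈R w≈w′ =
  init-last⇒pointwise {Q = _≈_} {w = w} {w′} init≈ last≈
  where
  c = fromℕ< (s≤s k+1<n)
  c≡k+2 = toℕ-fromℕ< (s≤s k+1<n)
  last≈ : last w ≈ last w′
  last≈ = R-preimage-injective k+1<n c c≡k+2 {last w} {last w′}
            (last⁺ (InR n) {w = w} w∈R) (last⁺ (InR n) {w = w′} w′∈R) (begin
    last w ⟨$⟩ˡ c   ≡⟨ last-factor-preimage {w = w} k+1<n w∈R c c≡k+2 ⟩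
    prod w ⟨$⟩ˡ c   ≡⟨ ⟨$⟩ˡ-resp-≈ (prod w) (prod w′) w≈w′ c ⟩
    prod w′ ⟨$⟩ˡ c  ≡⟨ last-factor-preimage {w = w′} k+1<n w′∈R c c≡k+2 ⟨
    last w′ ⟨$⟩ˡ c  ∎)
    where open ≡-Reasoning
  init≈ : ∀ j → init w j ≈ init w′ j
  init≈ = factorisation-unique k (≤-trans (n≤1+n _) k+1<n) {init w} {init w′}
    (init⁺ (InR n) {w = w} w∈R) (init⁺ (InR n) {w = w′} w′∈R)
    (·-cancelʳ {σ = prod (init w)} {prod (init w′)} (last w) λ x → begin
      prod (init w) ⟨$⟩ʳ (last w ⟨$⟩ʳ x)    ≡⟨ prod-init-last w x ⟨
      prod w ⟨$⟩ʳ x                        ≡⟨ w≈w′ x ⟩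
      prod w′ ⟨$⟩ʳ x                       ≡⟨ prod-init-last w′ x ⟩
      prod (init w′) ⟨$⟩ʳ (last w′ ⟨$⟩ʳ x)  ≡⟨ cong (prod (init w′) ⟨$⟩ʳ_) (last≈ x) ⟨
      prod (init w′) ⟨$⟩ʳ (last w ⟨$⟩ʳ x)   ∎)
    where open ≡-Reasoning

theorem3p4 : (n : ℕ) → 2 ≤ n → (v : Perm (suc n)) → IsEven v →
    Σ (Fin (n ∸ 1) → Perm (suc n)) (λ w →
      ((j : Fin (n ∸ 1)) → w j ∈ᴾ R n (toℕ j))
      × v ≈ prod w
      × ((w′ : Fin (n ∸ 1) → Perm (suc n)) →
          ((j : Fin (n ∸ 1)) → w′ j ∈ᴾ R n (toℕ j)) →
          v ≈ prod w′ →
          (j : Fin (n ∸ 1)) → w′ j ≈ w j))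
theorem3p4 (suc (suc n)) (s≤s (s≤s z≤n)) v v-even = w , w∈R , v≈w , λ w′ w′∈R v≈w′ →
  factorisation-unique (suc n) ≤-refl {w′} {w} w′∈R w∈R (λ x → trans (sym (v≈w′ x)) (v≈w x))
  where
  v∈A : Alt (suc (suc n)) v
  v∈A = record { fixing = FixesAbove-all v ; even = even⇒parity≡false {σ = v} v-even }
  factorisation = factorise (suc n) ≤-refl v v∈A
  w = proj₁ factorisation
  w∈R = proj₁ (proj₂ factorisation)
  v≈w = proj₂ (proj₂ factorisation)
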